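{- Let $G$ be an induced-subgraph-minimal non-sesquicograph. Then either $G$ is critically $2$-connected, or $G$ has vertex connectivity two and $\overline{G}$ has vertex connectivity one.
   Context: For vertex-disjoint graphs $G$ and $H$: the $0$-sum is their disjoint union; a $1$-sum is obtained from the disjoint union by identifying one vertex of $G$ with one vertex of $H$; the join is obtained from the disjoint union by adding all edges between $V(G)$ and $V(H)$. A sesquicograph is a finite simple graph that can be generated from the one-vertex graph $K_1$ using joins, $0$-sums and $1$-sums. An induced-subgraph-minimal non-sesquicograph is a graph that is not a sesquicograph but every proper induced subgraph of which is a sesquicograph. A graph is $2$-connected if it is connected, has at least three vertices, and has no cut vertex. A $2$-connected graph $H$ is critically $2$-connected if $H-v$ is not $2$-connected for every vertex $v$ of $H$. $\overline{G}$ denotes the complement of $G$. -}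

module Defs where

open import Data.Nat using (ℕ; zero; suc; _+_; _<_; _≤_)
open import Data.Fin using (Fin; splitAt; punchIn; _≟_)
open import Data.Fin.Subset using (Subset; _∈_; ⊤; ∁; _-_; ∣_∣)
open import Data.Bool using (Bool; true; false; not; if_then_else_)
open import Data.Sum using (_⊎_; inj₁; inj₂)
open import Data.Product using (_×_; Σ)
open import Relation.Binary.PropositionalEquality using (_≡_)
open import Relation.Nullary using (¬_)
open import Relation.Nullary.Decidable using (⌊_⌋)
open import Function.Definitions using (Injective)

record Graph : Set where
  constructor graph
  field
    n   : ℕ
    adj : Fin n → Fin n → Bool
open Graph public

IsSimple : Graph → Set
IsSimple G = (∀ i j → adj G i j ≡ adj G j i) × (∀ i → adj G i i ≡ false)

K₁ : Graph
K₁ = graph 1 (λ _ _ → false)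

-- Disjoint union (0-sum) and join, on vertex set Fin (n G + n H)
-- (first n G vertices are G's, the rest are H's).
private
  combine : (G H : Graph) → Bool → Fin (n G + n H) → Fin (n G + n H) → Bool
  combine G H b x y with splitAt (n G) x | splitAt (n G) y
  ... | inj₁ i | inj₁ j = adj G i j
  ... | inj₂ i | inj₂ j = adj H i j
  ... | inj₁ _ | inj₂ _ = b
  ... | inj₂ _ | inj₁ _ = b

sum0 : Graph → Graph → Graph
sum0 G H = graph (n G + n H) (combine G H false)

join : Graph → Graph → Graph
join G H = graph (n G + n H) (combine G H true)

-- 1-sum: identify vertex u of G with vertex v of H (H has suc m vertices).
-- Vertex set Fin (n G + m): first the vertices of G (u playing the role of
-- the identified vertex), then the vertices of H - v (j ↦ punchIn v j).
sum1 : (G : Graph) (u : Fin (n G)) (m : ℕ) (H : Fin (suc m) → Fin (suc m) → Bool)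
       (v : Fin (suc m)) → Graph
sum1 G u m H v = graph (n G + m) a
  where
  isU : Fin (n G) → Bool
  isU i = ⌊ i ≟ u ⌋
  a : Fin (n G + m) → Fin (n G + m) → Bool
  a x y with splitAt (n G) x | splitAt (n G) y
  ... | inj₁ i | inj₁ j = adj G i j
  ... | inj₂ i | inj₂ j = H (punchIn v i) (punchIn v j)
  ... | inj₁ i | inj₂ j = if isU i then H v (punchIn v j) else false
  ... | inj₂ i | inj₁ j = if isU j then H (punchIn v i) v else false

record _≅_ (G H : Graph) : Set where
  field
    to      : Fin (n G) → Fin (n H)
    from    : Fin (n H) → Fin (n G)
    to-from : ∀ y → to (from y) ≡ y
    from-to : ∀ x → from (to x) ≡ x
    pres    : ∀ x y → adj H (to x) (to y) ≡ adj G x y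

-- Sesquicographs: generated from K1 by joins, 0-sums and 1-sums
-- (closed under isomorphism, since graphs are considered up to isomorphism).
data Sesquicograph : Graph → Set where
  k1    : Sesquicograph K₁
  s0    : ∀ {G H} → Sesquicograph G → Sesquicograph H → Sesquicograph (sum0 G H)
  sjoin : ∀ {G H} → Sesquicograph G → Sesquicograph H → Sesquicograph (join G H)
  s1    : ∀ {G m H} (u : Fin (n G)) (v : Fin (suc m)) →
          Sesquicograph G → Sesquicograph (graph (suc m) H) →
          Sesquicograph (sum1 G u m H v)
  siso  : ∀ {G H} → G ≅ H → Sesquicograph G → Sesquicograph H

induced : (G : Graph) {k : ℕ} → (Fin k → Fin (n G)) → Graph
induced G {k} f = graph k (λ i j → adj G (f i) (f j))

-- Induced-subgraph-minimal non-sesquicograph (proper induced subgraphs are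
-- taken nonempty: graphs have at least one vertex).
MinimalNonSesquicograph : Graph → Set
MinimalNonSesquicograph G =
  ¬ Sesquicograph G ×
  (∀ k (f : Fin k → Fin (n G)) → Injective _≡_ _≡_ f → 1 ≤ k → k < n G →
     Sesquicograph (induced G f))

complement : Graph → Graph
complement G = graph (n G) (λ i j → if ⌊ i ≟ j ⌋ then false else not (adj G i j))

data Walk (G : Graph) (T : Subset (n G)) : Fin (n G) → Fin (n G) → Set where
  here : ∀ {i} → i ∈ T → Walk G T i i
  step : ∀ {i j k} → i ∈ T → adj G i j ≡ true → Walk G T j k → Walk G T i k

ConnectedOn : (G : Graph) → Subset (n G) → Set
ConnectedOn G T = ∀ i j → i ∈ T → j ∈ T → Walk G T i j

TwoConnectedOn : (G : Graph) → Subset (n G) → Set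
TwoConnectedOn G T =
  ConnectedOn G T × 3 ≤ ∣ T ∣ × (∀ v → v ∈ T → ConnectedOn G (T - v))

TwoConnected : Graph → Set
TwoConnected G = TwoConnectedOn G ⊤

CriticallyTwoConnected : Graph → Set
CriticallyTwoConnected G = TwoConnected G × (∀ v → ¬ TwoConnectedOn G (⊤ - v))

KConnected : ℕ → Graph → Set
KConnected k G = k < n G × (∀ (S : Subset (n G)) → ∣ S ∣ < k → ConnectedOn G (∁ S))

VertexConnectivity : Graph → ℕ → Set
VertexConnectivity G k = KConnected k G × ¬ KConnected (suc k) G

-- A minimal non-sesquicograph G is connected, has a connected complement and has no cut vertex:
-- otherwise G would be a 0-sum, a join or a 1-sum of two proper induced subgraphs, which are
-- sesquicographs.  So G is 2-connected, and it is critically 2-connected unless some G − v is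
-- 2-connected.  A 2-connected sesquicograph is a join, because 0-sums are disconnected and a 1-sum
-- of two graphs with at least two vertices each has a cut vertex.  Hence if G − v is 2-connected,
-- the complement of G − v is disconnected and κ(Ḡ) = 1.  Finally G is not 3-connected: otherwise
-- every G − x would be a join A ∨ B, and for r ∈ A the side of G − r not containing x, minus r,
-- would be a proper subset of A − x (this uses that Ḡ is connected), an infinite descent.

{-# OPTIONS --safe #-}
module Submission where

open import Defs
open import Data.Nat using (ℕ; zero; suc; _+_; _<_; _≤_; _≤?_; z≤n; s≤s)
open import Data.Nat.Properties
  using (n≤1+n; ≤-reflexive; +-suc; +-monoʳ-≤; +-monoˡ-≤; ≤-trans; <-≤-trans; ≤-refl; ≤⇒≯; ≤-pred; m+[n∸m]≡n)
open import Data.Nat.GeneralisedArithmetic using (fold)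
open import Data.Fin using (Fin; zero; suc; splitAt; punchIn; punchOut; _≟_; _↑ˡ_; _↑ʳ_)
import Data.Fin as Fin
open import Data.Fin.Properties
  using (any?; all?; ↑ˡ-injective; injective⇒≤; splitAt-join; join-splitAt; splitAt-↑ˡ; splitAt-↑ʳ;
         punchOut-cong; punchOut-punchIn; punchIn-punchOut; punchInᵢ≢i)
open import Data.Fin.Subset
  using (Subset; _∈_; _∉_; _⊆_; ⊤; ⁅_⁆; ∁; _∩_; _∪_; _─_; _-_; ∣_∣; Nonempty; inside; outside)
open import Data.Fin.Subset.Properties
open import Data.Vec using (_∷_; []; tabulate; here; there)
open import Data.Vec.Properties using (lookup∘tabulate; []=⇒lookup; lookup⇒[]=)
open import Data.Bool using (Bool; true; false)
open import Data.Bool.Properties using () renaming (_≟_ to _≟ᵇ_)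
open import Data.Sum using (_⊎_; inj₁; inj₂; [_,_]′; map₁; map₂)
open import Data.Sum.Properties using (inj₁-injective)
open import Data.Product using (_×_; Σ-syntax; ∃; _,_; proj₁; proj₂)
open import Data.Empty using (⊥; ⊥-elim)
open import Function using (_∘_; id)
open import Data.Vec.Functional using () renaming (_∷_ to _∷ᶠ_)
open import Function.Definitions using (Injective)
open import Relation.Binary.PropositionalEquality
open import Relation.Nullary using (¬_; Dec; yes; no; does)
open import Relation.Nullary.Decidable using (_×-dec_; _⊎-dec_; _→-dec_; dec-true; decidable-stable)
open import Relation.Unary using (Pred; Decidable)

private
  variable
    k l : ℕ

-- Subsets of Fin k

select : ∀ {ℓ} {P : Pred (Fin k) ℓ} → Decidable P → Subset k
select P? = tabulate (does ∘ P?)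

module _ {ℓ} {P : Pred (Fin k) ℓ} (P? : Decidable P) where

  ∈-select⁺ : ∀ {x} → P x → x ∈ select P?
  ∈-select⁺ {x} px = lookup⇒[]= x _ (trans (lookup∘tabulate _ x) (dec-true (P? x) px))

  ∈-select⁻ : ∀ {x} → x ∈ select P? → P x
  ∈-select⁻ {x} x∈ with P? x | trans (sym (lookup∘tabulate _ x)) ([]=⇒lookup x∈)
  ... | yes px | _  = px
  ... | no _   | ()

module _ (f : Fin k → Fin l) (p : Subset k) where

  private
    hit? : Decidable (λ y → ∃ λ x → x ∈ p × f x ≡ y)
    hit? y = any? (λ x → x ∈? p ×-dec f x ≟ y)

  image : Subset l
  image = select hit?

  ∈-image⁺ : ∀ {x} → x ∈ p → f x ∈ image
  ∈-image⁺ {x} x∈p = ∈-select⁺ hit? (x , x∈p , refl)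

  ∈-image⁻ : ∀ {y} → y ∈ image → ∃ λ x → x ∈ p × f x ≡ y
  ∈-image⁻ = ∈-select⁻ hit?

x∈p─q⇒x∉q : ∀ (p q : Subset k) {x} → x ∈ p ─ q → x ∉ q
x∈p─q⇒x∉q (_ ∷ p) (_ ∷ q) (there x∈) (there x∈q) = x∈p─q⇒x∉q p q x∈ x∈q

x∈p-y⇒x≢y : ∀ {p : Subset k} {x y} → x ∈ p - y → x ≢ y
x∈p-y⇒x≢y {p = p} {y = y} x∈ = x∉⁅y⁆⇒x≢y (x∈p─q⇒x∉q p ⁅ y ⁆ x∈)

∁p≡⊤─p : ∀ (p : Subset k) → ∁ p ≡ ⊤ ─ p
∁p≡⊤─p []            = refl
∁p≡⊤─p (inside ∷ p)  = cong (outside ∷_) (∁p≡⊤─p p)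
∁p≡⊤─p (outside ∷ p) = cong (inside ∷_) (∁p≡⊤─p p)

∣p∪q∣≤∣p∣+∣q∣ : ∀ (p q : Subset k) → ∣ p ∪ q ∣ ≤ ∣ p ∣ + ∣ q ∣
∣p∪q∣≤∣p∣+∣q∣ []            []            = z≤n
∣p∪q∣≤∣p∣+∣q∣ (inside ∷ p)  (inside ∷ q)  = s≤s (≤-trans (∣p∪q∣≤∣p∣+∣q∣ p q) (+-monoʳ-≤ ∣ p ∣ (n≤1+n ∣ q ∣)))
∣p∪q∣≤∣p∣+∣q∣ (inside ∷ p)  (outside ∷ q) = s≤s (∣p∪q∣≤∣p∣+∣q∣ p q)
∣p∪q∣≤∣p∣+∣q∣ (outside ∷ p) (inside ∷ q)  =
  subst (suc ∣ p ∪ q ∣ ≤_) (sym (+-suc ∣ p ∣ ∣ q ∣)) (s≤s (∣p∪q∣≤∣p∣+∣q∣ p q))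
∣p∪q∣≤∣p∣+∣q∣ (outside ∷ p) (outside ∷ q) = ∣p∪q∣≤∣p∣+∣q∣ p q

∣p∣+∣∁p∣≡n : ∀ (p : Subset k) → ∣ p ∣ + ∣ ∁ p ∣ ≡ k
∣p∣+∣∁p∣≡n {k} p = trans (cong (∣ p ∣ +_) (∣∁p∣≡n∸∣p∣ p)) (m+[n∸m]≡n (∣p∣≤n p))

x∈p⇒0<∣p∣ : ∀ {p : Subset k} {x} → x ∈ p → 0 < ∣ p ∣
x∈p⇒0<∣p∣ {p = p} {x} x∈p = subst (_≤ ∣ p ∣) (∣⁅x⁆∣≡1 x) (p⊆q⇒∣p∣≤∣q∣ ⁅x⁆⊆p)
  where
  ⁅x⁆⊆p : ⁅ x ⁆ ⊆ p
  ⁅x⁆⊆p y∈⁅x⁆ = subst (_∈ p) (sym (x∈⁅y⁆⇒x≡y x y∈⁅x⁆)) x∈p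

x∈p∧y∈p∧x≢y⇒1<∣p∣ : ∀ {p : Subset k} {x y} → x ∈ p → y ∈ p → x ≢ y → 1 < ∣ p ∣
x∈p∧y∈p∧x≢y⇒1<∣p∣ x∈p y∈p x≢y =
  <-≤-trans (s≤s (x∈p⇒0<∣p∣ (x∈p∧x≢y⇒x∈p-y y∈p (x≢y ∘ sym)))) (x∈p⇒∣p-x∣<∣p∣ x∈p)

x∉p⇒∣p∣<n : ∀ {p : Subset k} {x} → x ∉ p → ∣ p ∣ < k
x∉p⇒∣p∣<n {k} {p} {x} x∉p = subst (∣ p ∣ <_) (∣⊤∣≡n k) (p⊂q⇒∣p∣<∣q∣ (⊆⊤ , x , ∈⊤ , x∉p))

x∈∁⁅y⁆⇒x≢y : ∀ {x y : Fin k} → x ∈ ∁ ⁅ y ⁆ → x ≢ y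
x∈∁⁅y⁆⇒x≢y = x∉⁅y⁆⇒x≢y ∘ x∈∁p⇒x∉p

x≢y⇒x∈∁⁅y⁆ : ∀ {x y : Fin k} → x ≢ y → x ∈ ∁ ⁅ y ⁆
x≢y⇒x∈∁⁅y⁆ = x∉p⇒x∈∁p ∘ x≢y⇒x∉⁅y⁆

∣⊤-x∣ : ∀ (x : Fin k) → suc ∣ ⊤ - x ∣ ≡ k
∣⊤-x∣ {k} x = begin
  suc ∣ ⊤ - x ∣             ≡⟨ cong (suc ∘ ∣_∣) (∁p≡⊤─p ⁅ x ⁆) ⟨
  suc ∣ ∁ ⁅ x ⁆ ∣           ≡⟨ cong (_+ ∣ ∁ ⁅ x ⁆ ∣) (∣⁅x⁆∣≡1 x) ⟨
  ∣ ⁅ x ⁆ ∣ + ∣ ∁ ⁅ x ⁆ ∣   ≡⟨ ∣p∣+∣∁p∣≡n ⁅ x ⁆ ⟩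
  k                         ∎
  where open ≡-Reasoning

∷ᶠ-injective : ∀ {f : Fin k → Fin l} {v} → Injective _≡_ _≡_ f → (∀ i → f i ≢ v) →
               Injective _≡_ _≡_ (v ∷ᶠ f)
∷ᶠ-injective f-injective f≢v {zero}  {zero}  _  = refl
∷ᶠ-injective f-injective f≢v {zero}  {suc j} eq = ⊥-elim (f≢v j (sym eq))
∷ᶠ-injective f-injective f≢v {suc i} {zero}  eq = ⊥-elim (f≢v i eq)
∷ᶠ-injective f-injective f≢v {suc i} {suc j} eq = cong suc (f-injective eq)

enum : (p : Subset k) → Fin ∣ p ∣ → Fin k
enum (inside ∷ p)  zero    = zero
enum (inside ∷ p)  (suc i) = suc (enum p i)
enum (outside ∷ p) i       = suc (enum p i)

locate : (p : Subset k) → Fin k → Fin ∣ p ∣ ⊎ Fin ∣ ∁ p ∣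
locate (inside ∷ p)  zero    = inj₁ zero
locate (outside ∷ p) zero    = inj₂ zero
locate (inside ∷ p)  (suc x) = map₁ suc (locate p x)
locate (outside ∷ p) (suc x) = map₂ suc (locate p x)

unlocate : (p : Subset k) → Fin ∣ p ∣ ⊎ Fin ∣ ∁ p ∣ → Fin k
unlocate p = [ enum p , enum (∁ p) ]′

unlocate-locate : ∀ (p : Subset k) x → unlocate p (locate p x) ≡ x
unlocate-locate (inside ∷ p)  zero = refl
unlocate-locate (outside ∷ p) zero = refl
unlocate-locate (inside ∷ p)  (suc x) with locate p x | unlocate-locate p x
... | inj₁ _ | eq = cong suc eq
... | inj₂ _ | eq = cong suc eq
unlocate-locate (outside ∷ p) (suc x) with locate p x | unlocate-locate p x
... | inj₁ _ | eq = cong suc eq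
... | inj₂ _ | eq = cong suc eq

locate-enum : ∀ (p : Subset k) i → locate p (enum p i) ≡ inj₁ i
locate-enum (inside ∷ p)  zero    = refl
locate-enum (inside ∷ p)  (suc i) = cong (map₁ suc) (locate-enum p i)
locate-enum (outside ∷ p) i       = cong (map₂ suc) (locate-enum p i)

locate-enum∁ : ∀ (p : Subset k) i → locate p (enum (∁ p) i) ≡ inj₂ i
locate-enum∁ (inside ∷ p)  i       = cong (map₁ suc) (locate-enum∁ p i)
locate-enum∁ (outside ∷ p) zero    = refl
locate-enum∁ (outside ∷ p) (suc i) = cong (map₂ suc) (locate-enum∁ p i)

locate-unlocate : ∀ (p : Subset k) s → locate p (unlocate p s) ≡ s
locate-unlocate p (inj₁ i) = locate-enum p i
locate-unlocate p (inj₂ i) = locate-enum∁ p i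

enum-injective : ∀ (p : Subset k) → Injective _≡_ _≡_ (enum p)
enum-injective p {i} {j} eq =
  inj₁-injective (trans (sym (locate-enum p i)) (trans (cong (locate p) eq) (locate-enum p j)))

enum∈ : ∀ (p : Subset k) i → enum p i ∈ p
enum∈ (inside ∷ p)  zero    = here
enum∈ (inside ∷ p)  (suc i) = there (enum∈ p i)
enum∈ (outside ∷ p) i       = there (enum∈ p i)

enum-surjective : ∀ {p : Subset k} {x} → x ∈ p → ∃ λ i → enum p i ≡ x
enum-surjective {p = p} {x} x∈p with locate p x | unlocate-locate p x
... | inj₁ i | eq = i , eq
... | inj₂ i | eq = ⊥-elim (x∈∁p⇒x∉p (enum∈ (∁ p) i) (subst (_∈ p) (sym eq) x∈p))

inflationary⇒fixedPoint : (f : Subset k → Subset k) → (∀ {p} → p ⊆ f p) →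
                          ∀ p → ∃ λ j → f (fold p f j) ⊆ fold p f j
inflationary⇒fixedPoint {k} f inflationary p = [ id , too-large ]′ (search (suc k))
  where
  search : ∀ j → (∃ λ i → f (fold p f i) ⊆ fold p f i) ⊎ j ≤ ∣ fold p f j ∣
  search zero = inj₂ z≤n
  search (suc j) with search j
  ... | inj₁ found = inj₁ found
  ... | inj₂ j≤ with fold p f j ⊂? f (fold p f j)
  ...   | yes grows = inj₂ (≤-trans (s≤s j≤) (p⊂q⇒∣p∣<∣q∣ grows))
  ...   | no ¬grows = inj₁ (j , closed)
    where
    closed : f (fold p f j) ⊆ fold p f j
    closed {x} x∈ with x ∈? fold p f j
    ... | yes x∈′ = x∈′
    ... | no x∉   = ⊥-elim (¬grows (inflationary , x , x∈ , x∉))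
  too-large : suc k ≤ ∣ fold p f (suc k) ∣ → ∃ λ i → f (fold p f i) ⊆ fold p f i
  too-large = ⊥-elim ∘ ≤⇒≯ (∣p∣≤n (fold p f (suc k)))

-- Walks and connected components

module _ {G : Graph} {T : Subset (n G)} where

  walk-start : ∀ {i j} → Walk G T i j → i ∈ T
  walk-start (here i∈T)     = i∈T
  walk-start (step i∈T _ _) = i∈T

  walk-end : ∀ {i j} → Walk G T i j → j ∈ T
  walk-end (here j∈T)   = j∈T
  walk-end (step _ _ w) = walk-end w

  walk-snoc : ∀ {i j k} → Walk G T i j → adj G j k ≡ true → k ∈ T → Walk G T i k
  walk-snoc (here i∈T)       e k∈T = step i∈T e (here k∈T)
  walk-snoc (step i∈T e′ w) e k∈T = step i∈T e′ (walk-snoc w e k∈T)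

  walk-mono : ∀ {T′} → T ⊆ T′ → ∀ {i j} → Walk G T i j → Walk G T′ i j
  walk-mono T⊆T′ (here i∈T)     = here (T⊆T′ i∈T)
  walk-mono T⊆T′ (step i∈T e w) = step (T⊆T′ i∈T) e (walk-mono T⊆T′ w)

  walk-preserves : ∀ {ℓ} (P : Pred (Fin (n G)) ℓ) →
                   (∀ {x y} → x ∈ T → y ∈ T → adj G x y ≡ true → P x → P y) →
                   ∀ {i j} → Walk G T i j → P i → P j
  walk-preserves P step-preserves (here _)       Pi = Pi
  walk-preserves P step-preserves (step i∈T e w) Pi =
    walk-preserves P step-preserves w (step-preserves i∈T (walk-start w) e Pi)

walk⇒neighbour : ∀ {G T i j} → Walk G T i j → i ≢ j → ∃ λ k → adj G i k ≡ true
walk⇒neighbour (here _)     i≢i = ⊥-elim (i≢i refl)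
walk⇒neighbour (step _ e _) _   = _ , e

module Component (G : Graph) (T : Subset (n G)) (a : Fin (n G)) where

  private
    grown? : (p : Subset (n G)) → Decidable (λ y → y ∈ p ⊎ (y ∈ T × ∃ λ x → x ∈ p × adj G x y ≡ true))
    grown? p y = y ∈? p ⊎-dec (y ∈? T ×-dec any? (λ x → x ∈? p ×-dec adj G x y ≟ᵇ true))

  grow : Subset (n G) → Subset (n G)
  grow p = select (grown? p)

  layer : ℕ → Subset (n G)
  layer = fold (⁅ a ⁆ ∩ T) grow

  private
    stable : ∃ λ j → grow (layer j) ⊆ layer j
    stable = inflationary⇒fixedPoint grow (λ x∈p → ∈-select⁺ (grown? _) (inj₁ x∈p)) (⁅ a ⁆ ∩ T)

  component : Subset (n G)
  component = layer (proj₁ stable)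

  layer-walk : ∀ j {x} → x ∈ layer j → Walk G T a x
  layer-walk zero x∈ with x∈p∩q⁻ ⁅ a ⁆ T x∈
  ... | x∈⁅a⁆ , x∈T rewrite x∈⁅y⁆⇒x≡y a x∈⁅a⁆ = here x∈T
  layer-walk (suc j) x∈ with ∈-select⁻ (grown? _) x∈
  ... | inj₁ x∈layer              = layer-walk j x∈layer
  ... | inj₂ (x∈T , y , y∈layer , e) = walk-snoc (layer-walk j y∈layer) e x∈T

  component-walk : ∀ {x} → x ∈ component → Walk G T a x
  component-walk = layer-walk (proj₁ stable)

  component⊆T : component ⊆ T
  component⊆T = walk-end ∘ component-walk

  a∈component : a ∈ T → a ∈ component
  a∈component a∈T = start⊆layer (proj₁ stable) (x∈p∩q⁺ (x∈⁅x⁆ a , a∈T))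
    where
    start⊆layer : ∀ j → ⁅ a ⁆ ∩ T ⊆ layer j
    start⊆layer zero    x∈ = x∈
    start⊆layer (suc j) x∈ = ∈-select⁺ (grown? _) (inj₁ (start⊆layer j x∈))

  component-closed : ∀ {x y} → x ∈ component → y ∈ T → adj G x y ≡ true → y ∈ component
  component-closed {x} x∈ y∈T e = proj₂ stable (∈-select⁺ (grown? _) (inj₂ (y∈T , x , x∈ , e)))

  component-cross : ∀ {x y} → x ∈ component → y ∈ T → y ∉ component → adj G x y ≡ false
  component-cross {x} {y} x∈ y∈T y∉ with adj G x y in e
  ... | true  = ⊥-elim (y∉ (component-closed x∈ y∈T e))
  ... | false = refl

  walk⇒∈component : ∀ {y} → a ∈ T → Walk G T a y → y ∈ component
  walk⇒∈component a∈T w =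
    walk-preserves (_∈ component) (λ _ y∈T e x∈ → component-closed x∈ y∈T e) w (a∈component a∈T)

open Component
  using (component; component-walk; component⊆T; a∈component; component-cross; walk⇒∈component)

connectedOn? : (G : Graph) (T : Subset (n G)) → Dec (ConnectedOn G T)
connectedOn? G T with all? (λ i → all? (λ j → i ∈? T →-dec j ∈? T →-dec j ∈? component G T i))
... | yes reach = yes (λ i j i∈T j∈T → component-walk G T i (reach i j i∈T j∈T))
... | no ¬reach = no (λ conn → ¬reach (λ i j i∈T j∈T → walk⇒∈component G T i i∈T (conn i j i∈T j∈T)))

twoConnectedOn? : (G : Graph) (T : Subset (n G)) → Dec (TwoConnectedOn G T)
twoConnectedOn? G T =
  connectedOn? G T ×-dec 3 ≤? ∣ T ∣ ×-dec all? (λ v → v ∈? T →-dec connectedOn? G (T - v))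

module _ {K G : Graph} (f : Fin (n K) → Fin (n G)) (f-injective : Injective _≡_ _≡_ f)
         (f-adj : ∀ i j → adj G (f i) (f j) ≡ adj K i j) where

  walk-pullback : ∀ {U : Subset (n G)} {U′ : Subset (n K)} →
                  (∀ {z} → z ∈ U → ∃ λ i → f i ≡ z) → (∀ {i} → f i ∈ U → i ∈ U′) →
                  ∀ {c d i j} → Walk G U c d → f i ≡ c → f j ≡ d → Walk K U′ i j
  walk-pullback onto back (here c∈U) refl fj≡fi rewrite f-injective fj≡fi = here (back c∈U)
  walk-pullback onto back (step c∈U e w) refl fj≡d with onto (walk-start w)
  ... | k , refl = step (back c∈U) (trans (sym (f-adj _ k)) e) (walk-pullback onto back w refl fj≡d)

  twoConnected-pullback : ∀ {T} → (∀ i → f i ∈ T) → (∀ {z} → z ∈ T → ∃ λ i → f i ≡ z) →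
                          ∣ T ∣ ≤ n K → TwoConnectedOn G T → TwoConnected K
  twoConnected-pullback {T} into onto ∣T∣≤ (connected , 3≤∣T∣ , cut) =
    (λ i j _ _ → walk-pullback onto (λ _ → ∈⊤) (connected (f i) (f j) (into i) (into j)) refl refl) ,
    subst (3 ≤_) (sym (∣⊤∣≡n (n K))) (≤-trans 3≤∣T∣ ∣T∣≤) ,
    λ w _ i j i∈ j∈ → walk-pullback (onto ∘ p─q⊆p T ⁅ f w ⁆) preimage-avoids
                        (cut (f w) (into w) (f i) (f j) (image-avoids i∈) (image-avoids j∈)) refl refl
    where
    preimage-avoids : ∀ {w i} → f i ∈ T - f w → i ∈ ⊤ - w
    preimage-avoids fi∈ = x∈p∧x≢y⇒x∈p-y ∈⊤ (x∈p-y⇒x≢y fi∈ ∘ cong f)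
    image-avoids : ∀ {w i} → i ∈ ⊤ - w → f i ∈ T - f w
    image-avoids {i = i} i∈ = x∈p∧x≢y⇒x∈p-y (into i) (x∈p-y⇒x≢y i∈ ∘ f-injective)

3-connected⇒twoConnected-minus : ∀ {G} → KConnected 3 G → ∀ x → TwoConnectedOn G (⊤ - x)
3-connected⇒twoConnected-minus {G} (3<n , connected-without) x =
  subst (ConnectedOn G) (∁p≡⊤─p ⁅ x ⁆) (connected-without ⁅ x ⁆ ∣⁅x⁆∣<3) ,
  ≤-pred (subst (3 <_) (sym (∣⊤-x∣ x)) 3<n) ,
  λ w _ → subst (ConnectedOn G) (∁⁅x⁆∪⁅w⁆≡⊤-x-w w) (connected-without (⁅ x ⁆ ∪ ⁅ w ⁆) (∣⁅x⁆∪⁅w⁆∣<3 w))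
  where
  ∣⁅x⁆∣<3 : ∣ ⁅ x ⁆ ∣ < 3
  ∣⁅x⁆∣<3 = subst (_< 3) (sym (∣⁅x⁆∣≡1 x)) (s≤s (s≤s z≤n))
  ∣⁅x⁆∪⁅w⁆∣<3 : ∀ w → ∣ ⁅ x ⁆ ∪ ⁅ w ⁆ ∣ < 3
  ∣⁅x⁆∪⁅w⁆∣<3 w =
    s≤s (≤-trans (∣p∪q∣≤∣p∣+∣q∣ ⁅ x ⁆ ⁅ w ⁆) (≤-reflexive (cong₂ _+_ (∣⁅x⁆∣≡1 x) (∣⁅x⁆∣≡1 w))))
  ∁⁅x⁆∪⁅w⁆≡⊤-x-w : ∀ w → ∁ (⁅ x ⁆ ∪ ⁅ w ⁆) ≡ ⊤ - x - w
  ∁⁅x⁆∪⁅w⁆≡⊤-x-w w = trans (∁p≡⊤─p (⁅ x ⁆ ∪ ⁅ w ⁆)) (sym (p─q─r≡p─q∪r ⊤ ⁅ x ⁆ ⁅ w ⁆))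

complement⇒¬adj : ∀ {G x y} → adj (complement G) x y ≡ true → adj G x y ≢ true
complement⇒¬adj {G} {x} {y} e e′ with x ≟ y | adj G x y
complement⇒¬adj () _    | yes _ | _
complement⇒¬adj () refl | no _  | true

¬complement⇒adj : ∀ {G x y} → x ≢ y → adj (complement G) x y ≡ false → adj G x y ≡ true
¬complement⇒adj {G} {x} {y} x≢y e with x ≟ y | adj G x y
... | yes x≡y | _    = ⊥-elim (x≢y x≡y)
... | no _    | true = refl

-- Decomposing a graph along a vertex subset

module Decomposition (G : Graph) (S : Subset (n G)) where

  private
    a b : ℕ
    a = ∣ S ∣
    b = ∣ ∁ S ∣

  inner outer : Graph
  inner = induced G (enum S)
  outer = induced G (enum (∁ S))

  vertex : Fin (a + b) → Fin (n G)
  vertex x = unlocate S (splitAt a x)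

  ≅G : (adjH : Fin (a + b) → Fin (a + b) → Bool) →
       (∀ x y → adj G (vertex x) (vertex y) ≡ adjH x y) → graph (a + b) adjH ≅ G
  ≅G adjH pres = record
    { to      = vertex
    ; from    = Fin.join a b ∘ locate S
    ; to-from = λ y → trans (cong (unlocate S) (splitAt-join a b (locate S y))) (unlocate-locate S y)
    ; from-to = λ x → trans (cong (Fin.join a b) (locate-unlocate S (splitAt a x))) (join-splitAt a b x)
    ; pres    = pres
    }

  module _ (symmetric : ∀ x y → adj G x y ≡ adj G y x) where

    sum0≅ : (∀ {x y} → x ∈ S → y ∉ S → adj G x y ≡ false) → sum0 inner outer ≅ G
    sum0≅ cross = ≅G _ pres
      where
      pres : ∀ x y → adj G (vertex x) (vertex y) ≡ adj (sum0 inner outer) x y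
      pres x y with splitAt a x | splitAt a y
      ... | inj₁ i | inj₁ j = refl
      ... | inj₂ i | inj₂ j = refl
      ... | inj₁ i | inj₂ j = cross (enum∈ S i) (x∈∁p⇒x∉p (enum∈ (∁ S) j))
      ... | inj₂ i | inj₁ j = trans (symmetric _ _) (cross (enum∈ S j) (x∈∁p⇒x∉p (enum∈ (∁ S) i)))

    join≅ : (∀ {x y} → x ∈ S → y ∉ S → adj G x y ≡ true) → join inner outer ≅ G
    join≅ cross = ≅G _ pres
      where
      pres : ∀ x y → adj G (vertex x) (vertex y) ≡ adj (join inner outer) x y
      pres x y with splitAt a x | splitAt a y
      ... | inj₁ i | inj₁ j = refl
      ... | inj₂ i | inj₂ j = refl
      ... | inj₁ i | inj₂ j = cross (enum∈ S i) (x∈∁p⇒x∉p (enum∈ (∁ S) j))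
      ... | inj₂ i | inj₁ j = trans (symmetric _ _) (cross (enum∈ S j) (x∈∁p⇒x∉p (enum∈ (∁ S) i)))

    module _ {v : Fin (n G)} (u : Fin a) (enum-u : enum S u ≡ v) where

      attached : Graph
      attached = induced G (v ∷ᶠ enum (∁ S))

      sum1≅ : (∀ {x y} → x ∈ S → y ∉ S → x ≢ v → adj G x y ≡ false) →
              sum1 inner u b (adj attached) zero ≅ G
      sum1≅ cross = ≅G _ pres
        where
        off-cut : ∀ {i} → i ≢ u → enum S i ≢ v
        off-cut i≢u eq = i≢u (enum-injective S (trans eq (sym enum-u)))
        pres : ∀ x y → adj G (vertex x) (vertex y) ≡ adj (sum1 inner u b (adj attached) zero) x y
        pres x y with splitAt a x | splitAt a y
        ... | inj₁ i | inj₁ j = refl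
        ... | inj₂ i | inj₂ j = refl
        ... | inj₁ i | inj₂ j with i ≟ u
        ...   | yes refl = cong (λ z → adj G z (enum (∁ S) j)) enum-u
        ...   | no i≢u   = cross (enum∈ S i) (x∈∁p⇒x∉p (enum∈ (∁ S) j)) (off-cut i≢u)
        pres x y | inj₂ i | inj₁ j with j ≟ u
        ...   | yes refl = cong (adj G (enum (∁ S) i)) enum-u
        ...   | no j≢u   = trans (symmetric _ _)
                             (cross (enum∈ S j) (x∈∁p⇒x∉p (enum∈ (∁ S) i)) (off-cut j≢u))

-- 2-connected sesquicographs are joins

IsLeft : ∀ k {l} → Fin (k + l) → Set
IsLeft k x = ∃ λ i → splitAt k x ≡ inj₁ i

left⇒≡↑ˡ : ∀ {x : Fin (k + l)} {i} → splitAt k x ≡ inj₁ i → x ≡ i ↑ˡ l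
left⇒≡↑ˡ {k} {l} {x} eq = trans (sym (join-splitAt k l x)) (cong (Fin.join k l) eq)

↑ʳ-not-left : ∀ k {l} (j : Fin l) → ¬ IsLeft k (k ↑ʳ j)
↑ʳ-not-left k j (i , eq) with trans (sym eq) (splitAt-↑ʳ k _ j)
... | ()

sesquicograph-loopless : ∀ {H} → Sesquicograph H → ∀ i → adj H i i ≡ false
sesquicograph-loopless k1 i = refl
sesquicograph-loopless (s0 {G} sG sH) x with splitAt (n G) x
... | inj₁ i = sesquicograph-loopless sG i
... | inj₂ i = sesquicograph-loopless sH i
sesquicograph-loopless (sjoin {G} sG sH) x with splitAt (n G) x
... | inj₁ i = sesquicograph-loopless sG i
... | inj₂ i = sesquicograph-loopless sH i
sesquicograph-loopless (s1 {G} u v sG sH) x with splitAt (n G) x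
... | inj₁ i = sesquicograph-loopless sG i
... | inj₂ i = sesquicograph-loopless sH (punchIn v i)
sesquicograph-loopless (siso {G} {H} iso s) x =
  trans (cong₂ (adj H) (sym (to-from x)) (sym (to-from x)))
        (trans (pres _ _) (sesquicograph-loopless s (from x)))
  where open _≅_ iso

someVertex : ∀ {H} → Sesquicograph H → Fin (n H)
someVertex k1                     = zero
someVertex (s0 {H = H} sG _)      = someVertex sG ↑ˡ n H
someVertex (sjoin {H = H} sG _)   = someVertex sG ↑ˡ n H
someVertex (s1 {m = m} _ _ sG _)  = someVertex sG ↑ˡ m
someVertex (siso iso s)           = _≅_.to iso (someVertex s)

JoinSplit : Graph → Set
JoinSplit H = Σ[ S ∈ Subset (n H) ] Nonempty S × (∃ λ y → y ∉ S) ×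
              (∀ {x y} → x ∈ S → y ∉ S → adj H x y ≡ true)

module _ {K G : Graph} (iso : K ≅ G) where

  open _≅_ iso

  private
    to-injective : Injective _≡_ _≡_ to
    to-injective {x} {y} eq = trans (sym (from-to x)) (trans (cong from eq) (from-to y))

    from-injective : Injective _≡_ _≡_ from
    from-injective {x} {y} eq = trans (sym (to-from x)) (trans (cong to eq) (to-from y))

  ≅-twoConnected : TwoConnected G → TwoConnected K
  ≅-twoConnected = twoConnected-pullback to to-injective pres (λ _ → ∈⊤) (λ {z} _ → from z , to-from z)
                     (subst (_≤ n K) (sym (∣⊤∣≡n (n G))) (injective⇒≤ from-injective))

  ≅-joinSplit : JoinSplit K → JoinSplit G
  ≅-joinSplit (S , (a , a∈S) , (b , b∉S) , cross) =
    image to S , (to a , ∈-image⁺ to S a∈S) , (to b , to-b∉) , cross′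
    where
    to-b∉ : to b ∉ image to S
    to-b∉ to-b∈ with ∈-image⁻ to S to-b∈
    ... | x , x∈S , eq = b∉S (subst (_∈ S) (to-injective eq) x∈S)
    cross′ : ∀ {x y} → x ∈ image to S → y ∉ image to S → adj G x y ≡ true
    cross′ {y = y} x∈ y∉ with ∈-image⁻ to S x∈
    ... | i , i∈S , refl =
      trans (cong (adj G (to i)) (sym (to-from y))) (trans (pres i (from y)) (cross i∈S from-y∉S))
      where
      from-y∉S : from y ∉ S
      from-y∉S from-y∈ = y∉ (subst (_∈ image to S) (to-from y) (∈-image⁺ to S from-y∈))

sum0-disconnected : ∀ {A B} → Fin (n A) → Fin (n B) → ¬ ConnectedOn (sum0 A B) ⊤
sum0-disconnected {A} {B} a b connected =
  ↑ʳ-not-left (n A) b (walk-preserves (IsLeft (n A)) stays-left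
    (connected (a ↑ˡ n B) (n A ↑ʳ b) ∈⊤ ∈⊤) (a , splitAt-↑ˡ (n A) a (n B)))
  where
  stays-left : ∀ {x y} → x ∈ ⊤ → y ∈ ⊤ → adj (sum0 A B) x y ≡ true → IsLeft (n A) x → IsLeft (n A) y
  stays-left {x} {y} _ _ e x-left with splitAt (n A) x | splitAt (n A) y
  ... | inj₁ _ | inj₁ j = j , refl
  ... | inj₁ _ | inj₂ _ with e
  ...   | ()
  stays-left _ _ _ (_ , ()) | inj₂ _ | _

join-joinSplit : ∀ {A B} → Fin (n A) → Fin (n B) → JoinSplit (join A B)
join-joinSplit {A} {B} a b =
  left , (a ↑ˡ n B , ∈-image⁺ (_↑ˡ n B) ⊤ ∈⊤) , (n A ↑ʳ b , ↑ʳ∉left) , cross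
  where
  left : Subset (n A + n B)
  left = image (_↑ˡ n B) ⊤
  ↑ʳ∉left : n A ↑ʳ b ∉ left
  ↑ʳ∉left ↑ʳ∈ with ∈-image⁻ (_↑ˡ n B) ⊤ ↑ʳ∈
  ... | i , _ , eq =
    ↑ʳ-not-left (n A) b (i , trans (cong (splitAt (n A)) (sym eq)) (splitAt-↑ˡ (n A) i (n B)))
  cross : ∀ {x y} → x ∈ left → y ∉ left → adj (join A B) x y ≡ true
  cross {y = y} x∈ y∉ with ∈-image⁻ (_↑ˡ n B) ⊤ x∈
  ... | i , _ , refl rewrite splitAt-↑ˡ (n A) i (n B) with splitAt (n A) y in y-side
  ...   | inj₁ j = ⊥-elim (y∉ (subst (_∈ left) (sym (left⇒≡↑ˡ y-side)) (∈-image⁺ (_↑ˡ n B) ⊤ ∈⊤)))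
  ...   | inj₂ j = refl

sum1-cutVertex : ∀ {A m B v} (u a : Fin (n A)) → a ≢ u →
                 ¬ ConnectedOn (sum1 A u (suc m) B v) (⊤ - (u ↑ˡ suc m))
sum1-cutVertex {A} {m} {B} {v} u a a≢u connected =
  ↑ʳ-not-left (n A) zero (walk-preserves (IsLeft (n A)) stays-left
    (connected (a ↑ˡ suc m) (n A ↑ʳ zero) a-avoids-u ↑ʳ-avoids-u) (a , splitAt-↑ˡ (n A) a (suc m)))
  where
  H : Graph
  H = sum1 A u (suc m) B v
  a-avoids-u : a ↑ˡ suc m ∈ ⊤ - (u ↑ˡ suc m)
  a-avoids-u = x∈p∧x≢y⇒x∈p-y ∈⊤ (a≢u ∘ ↑ˡ-injective (suc m) a u)
  ↑ʳ-avoids-u : n A ↑ʳ zero ∈ ⊤ - (u ↑ˡ suc m)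
  ↑ʳ-avoids-u = x∈p∧x≢y⇒x∈p-y ∈⊤ λ eq →
    ↑ʳ-not-left (n A) zero (u , trans (cong (splitAt (n A)) eq) (splitAt-↑ˡ (n A) u (suc m)))
  stays-left : ∀ {x y} → x ∈ ⊤ - (u ↑ˡ suc m) → y ∈ ⊤ - (u ↑ˡ suc m) →
               adj H x y ≡ true → IsLeft (n A) x → IsLeft (n A) y
  stays-left {x} {y} x∈ _ e x-left with splitAt (n A) x in x-side | splitAt (n A) y
  ... | inj₁ _ | inj₁ j = j , refl
  ... | inj₁ i | inj₂ _ with i ≟ u
  ...   | yes refl = ⊥-elim (x∈p-y⇒x≢y x∈ (left⇒≡↑ˡ x-side))
  ...   | no _ with e
  ...     | ()
  stays-left _ _ _ (_ , ()) | inj₂ _ | _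

≅sum1-K₁ˡ : ∀ {a m B v} → a zero zero ≡ false → B v v ≡ false →
           graph (suc m) B ≅ sum1 (graph 1 a) zero m B v
≅sum1-K₁ˡ {a} {m} {B} {v} a-loopless B-loopless = record
  { to = to ; from = from ; to-from = to-from ; from-to = from-to ; pres = pres }
  where
  to : Fin (suc m) → Fin (suc m)
  to y with v ≟ y
  ... | yes _   = zero
  ... | no v≢y = suc (punchOut v≢y)
  from : Fin (suc m) → Fin (suc m)
  from zero    = v
  from (suc j) = punchIn v j
  to-from : ∀ y → to (from y) ≡ y
  to-from zero with v ≟ v
  ... | yes _   = refl
  ... | no v≢v = ⊥-elim (v≢v refl)
  to-from (suc j) with v ≟ punchIn v j
  ... | yes v≡ = ⊥-elim (punchInᵢ≢i v j (sym v≡))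
  ... | no _   = cong suc (trans (punchOut-cong v refl) (punchOut-punchIn v))
  from-to : ∀ x → from (to x) ≡ x
  from-to x with v ≟ x
  ... | yes v≡x = v≡x
  ... | no v≢x  = punchIn-punchOut v≢x
  pres : ∀ x y → adj (sum1 (graph 1 a) zero m B v) (to x) (to y) ≡ B x y
  pres x y with v ≟ x | v ≟ y
  ... | yes refl | yes refl = trans a-loopless (sym B-loopless)
  ... | yes refl | no v≢y  = cong (B v) (punchIn-punchOut v≢y)
  ... | no v≢x  | yes refl = cong (λ z → B z v) (punchIn-punchOut v≢x)
  ... | no v≢x  | no v≢y  = cong₂ B (punchIn-punchOut v≢x) (punchIn-punchOut v≢y)

≅sum1-K₁ʳ : ∀ {A u B v} → A ≅ sum1 A u 0 B v
≅sum1-K₁ʳ {A} {u} {B} {v} = record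
  { to = _↑ˡ 0 ; from = from ; to-from = to-from ; from-to = from-to ; pres = pres }
  where
  from : Fin (n A + 0) → Fin (n A)
  from x with splitAt (n A) x
  ... | inj₁ i = i
  to-from : ∀ y → from y ↑ˡ 0 ≡ y
  to-from y with splitAt (n A) y in y-side
  ... | inj₁ i = sym (left⇒≡↑ˡ y-side)
  from-to : ∀ x → from (x ↑ˡ 0) ≡ x
  from-to x rewrite splitAt-↑ˡ (n A) x 0 = refl
  pres : ∀ x y → adj (sum1 A u 0 B v) (x ↑ˡ 0) (y ↑ˡ 0) ≡ adj A x y
  pres x y rewrite splitAt-↑ˡ (n A) x 0 | splitAt-↑ˡ (n A) y 0 = refl

joinSplit-via-≅ : ∀ {K H} → K ≅ H → (TwoConnected K → JoinSplit K) → TwoConnected H → JoinSplit H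
joinSplit-via-≅ iso split = ≅-joinSplit iso ∘ split ∘ ≅-twoConnected iso

twoConnected⇒joinSplit : ∀ {H} → Sesquicograph H → TwoConnected H → JoinSplit H
twoConnected⇒joinSplit k1 (_ , s≤s () , _)
twoConnected⇒joinSplit (s0 sA sB) (connected , _) =
  ⊥-elim (sum0-disconnected (someVertex sA) (someVertex sB) connected)
twoConnected⇒joinSplit (sjoin sA sB) _ = join-joinSplit (someVertex sA) (someVertex sB)
twoConnected⇒joinSplit (s1 {graph zero _} () _ _ _)
twoConnected⇒joinSplit (s1 {graph 1 _} zero v sA sB) =
  joinSplit-via-≅ (≅sum1-K₁ˡ (sesquicograph-loopless sA zero) (sesquicograph-loopless sB v))
                  (twoConnected⇒joinSplit sB)
twoConnected⇒joinSplit (s1 {graph (suc (suc _)) _} {zero} _ _ sA _) =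
  joinSplit-via-≅ ≅sum1-K₁ʳ (twoConnected⇒joinSplit sA)
twoConnected⇒joinSplit (s1 {graph (suc (suc _)) _} {suc m} u _ _ _) (_ , _ , cut) =
  ⊥-elim (sum1-cutVertex u (punchIn u zero) (punchInᵢ≢i u zero) (cut (u ↑ˡ suc m) ∈⊤))
twoConnected⇒joinSplit (siso iso s) = joinSplit-via-≅ iso (twoConnected⇒joinSplit s)


-- Minimal non-sesquicographs

module Minimal {G : Graph} (simple : IsSimple G) (minimal : MinimalNonSesquicograph G) where

  private
    symmetric : ∀ x y → adj G x y ≡ adj G y x
    symmetric = proj₁ simple

    nonSesquicograph : ¬ Sesquicograph G
    nonSesquicograph = proj₁ minimal

  proper-induced : ∀ {S : Subset (n G)} {x y} → x ∈ S → y ∉ S → Sesquicograph (induced G (enum S))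
  proper-induced {S} x∈S y∉S =
    proj₂ minimal ∣ S ∣ (enum S) (enum-injective S) (x∈p⇒0<∣p∣ x∈S) (x∉p⇒∣p∣<n y∉S)

  module _ {S : Subset (n G)} {x y} (x∈S : x ∈ S) (y∉S : y ∉ S) where

    private
      outer-sesquicograph : Sesquicograph (induced G (enum (∁ S)))
      outer-sesquicograph = proper-induced (x∉p⇒x∈∁p y∉S) (x∈p⇒x∉∁p x∈S)

    not-sum0 : ¬ (∀ {a b} → a ∈ S → b ∉ S → adj G a b ≡ false)
    not-sum0 cross = nonSesquicograph
      (siso (Decomposition.sum0≅ G S symmetric cross) (s0 (proper-induced x∈S y∉S) outer-sesquicograph))

    not-join : ¬ (∀ {a b} → a ∈ S → b ∉ S → adj G a b ≡ true)
    not-join cross = nonSesquicograph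
      (siso (Decomposition.join≅ G S symmetric cross) (sjoin (proper-induced x∈S y∉S) outer-sesquicograph))

  not-sum1 : ∀ {S : Subset (n G)} {v x y} → v ∈ S → x ∈ S → x ≢ v → y ∉ S →
             ¬ (∀ {a b} → a ∈ S → b ∉ S → a ≢ v → adj G a b ≡ false)
  not-sum1 {S} {v} v∈S x∈S x≢v y∉S cross with enum-surjective v∈S
  ... | u , enum-u = nonSesquicograph
    (siso (Decomposition.sum1≅ G S symmetric u enum-u cross) (s1 u zero (proper-induced v∈S y∉S) attached))
    where
    attached : Sesquicograph (induced G (v ∷ᶠ enum (∁ S)))
    attached = proj₂ minimal (suc ∣ ∁ S ∣) (v ∷ᶠ enum (∁ S))
      (∷ᶠ-injective (enum-injective (∁ S)) (λ i eq → x∈∁p⇒x∉p (enum∈ (∁ S) i) (subst (_∈ S) (sym eq) v∈S)))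
      (s≤s z≤n)
      (subst (suc (suc ∣ ∁ S ∣) ≤_) (∣p∣+∣∁p∣≡n S)
        (+-monoˡ-≤ ∣ ∁ S ∣ (x∈p∧y∈p∧x≢y⇒1<∣p∣ v∈S x∈S (x≢v ∘ sym))))

  connected : ConnectedOn G ⊤
  connected i j _ _ with j ∈? component G ⊤ i
  ... | yes j∈ = component-walk G ⊤ i j∈
  ... | no j∉  = ⊥-elim (not-sum0 (a∈component G ⊤ i ∈⊤) j∉ (λ a∈ b∉ → component-cross G ⊤ i a∈ ∈⊤ b∉))

  complement-connected : ConnectedOn (complement G) ⊤
  complement-connected i j _ _ with j ∈? component (complement G) ⊤ i
  ... | yes j∈ = component-walk (complement G) ⊤ i j∈
  ... | no j∉  = ⊥-elim (not-join (a∈component (complement G) ⊤ i ∈⊤) j∉ cross)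
    where
    C : Subset (n G)
    C = component (complement G) ⊤ i
    cross : ∀ {a b} → a ∈ C → b ∉ C → adj G a b ≡ true
    cross {a} {b} a∈ b∉ =
      ¬complement⇒adj {G} {a} {b} (λ { refl → b∉ a∈ }) (component-cross (complement G) ⊤ i a∈ ∈⊤ b∉)

  connected-minus : ∀ v → ConnectedOn G (⊤ - v)
  connected-minus v i j i∈ j∈ with j ∈? component G (⊤ - v) i
  ... | yes j∈C = component-walk G (⊤ - v) i j∈C
  ... | no j∉C  = ⊥-elim
    (not-sum1 v∈∁C (x∉p⇒x∈∁p j∉C) (x∈p-y⇒x≢y j∈) (x∈p⇒x∉∁p (a∈component G (⊤ - v) i i∈)) cross)
    where
    C : Subset (n G)
    C = component G (⊤ - v) i
    v∈∁C : v ∈ ∁ C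
    v∈∁C = x∉p⇒x∈∁p (λ v∈C → x∈p-y⇒x≢y (component⊆T G (⊤ - v) i v∈C) refl)
    cross : ∀ {a b} → a ∈ ∁ C → b ∉ ∁ C → a ≢ v → adj G a b ≡ false
    cross {a} {b} a∈ b∉ a≢v = trans (symmetric a b)
      (component-cross G (⊤ - v) i (x∉∁p⇒x∈p b∉) (x∈p∧x≢y⇒x∈p-y ∈⊤ a≢v) (x∈∁p⇒x∉p a∈))

  twoConnected : 3 ≤ n G → TwoConnected G
  twoConnected 3≤n = connected , subst (3 ≤_) (sym (∣⊤∣≡n (n G))) 3≤n , λ v _ → connected-minus v

  CompleteAcross : Fin (n G) → Subset (n G) → Set
  CompleteAcross x S = ∀ {y z} → y ≢ x → z ≢ x → y ∈ S → z ∉ S → adj G y z ≡ true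

  JoinSplitMinus : Fin (n G) → Set
  JoinSplitMinus x = Σ[ S ∈ Subset (n G) ] (∃ λ a → a ≢ x × a ∈ S) × (∃ λ b → b ≢ x × b ∉ S) ×
                     CompleteAcross x S

  joinSplitMinus : ∀ x → TwoConnectedOn G (⊤ - x) → JoinSplitMinus x
  joinSplitMinus x twoConnected@(_ , 3≤∣T∣ , _) =
    push (twoConnected⇒joinSplit (proper-induced (enum∈ T some) (λ x∈T → x∈p-y⇒x≢y x∈T refl))
           (twoConnected-pullback (enum T) (enum-injective T) (λ _ _ → refl) (enum∈ T) enum-surjective ≤-refl
              twoConnected))
    where
    T : Subset (n G)
    T = ⊤ - x
    some : Fin ∣ T ∣
    some = Fin.fromℕ< (≤-trans (s≤s z≤n) 3≤∣T∣)
    push : JoinSplit (induced G (enum T)) → JoinSplitMinus x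
    push (S , (a , a∈S) , (b , b∉S) , cross) =
      image (enum T) S ,
      (enum T a , x∈p-y⇒x≢y (enum∈ T a) , ∈-image⁺ (enum T) S a∈S) ,
      (enum T b , x∈p-y⇒x≢y (enum∈ T b) , b∉) ,
      cross′
      where
      b∉ : enum T b ∉ image (enum T) S
      b∉ b∈ with ∈-image⁻ (enum T) S b∈
      ... | i , i∈S , eq = b∉S (subst (_∈ S) (enum-injective T eq) i∈S)
      cross′ : CompleteAcross x (image (enum T) S)
      cross′ _ z≢x y∈ z∉ with ∈-image⁻ (enum T) S y∈ | enum-surjective (x∈p∧x≢y⇒x∈p-y ∈⊤ z≢x)
      ... | i , i∈S , refl | j , refl = cross i∈S (z∉ ∘ ∈-image⁺ (enum T) S)

  CompleteAcross-∁ : ∀ {x S} → CompleteAcross x S → CompleteAcross x (∁ S)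
  CompleteAcross-∁ cross y≢x z≢x y∈∁S z∉∁S =
    trans (symmetric _ _) (cross z≢x y≢x (x∉∁p⇒x∈p z∉∁S) (x∈∁p⇒x∉p y∈∁S))

  complement-edge-keeps-side : ∀ {x S y z} → CompleteAcross x S → y ≢ x → z ≢ x →
                               adj (complement G) y z ≡ true → y ∈ S → z ∈ S
  complement-edge-keeps-side {S = S} {z = z} cross y≢x z≢x e y∈S = decidable-stable (z ∈? S) λ z∉S →
    complement⇒¬adj {G} e (cross y≢x z≢x y∈S z∉S)

  -- A vertex of S′ outside S reaches x by a path of the complement whose inner vertices stay
  -- outside S ∪ {x}, hence avoid r; the complement edges of that path never leave S′.
  shrink : ∀ {x S r S′} → CompleteAcross x S → r ≢ x → r ∈ S → CompleteAcross r S′ → x ∉ S′ →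
           ∣ S′ - r ∣ < ∣ S - x ∣
  shrink {x} {S} {r} {S′} cross r≢x r∈S cross′ x∉S′ =
    p⊂q⇒∣p∣<∣q∣ (S′-r⊆S-x , r , x∈p∧x≢y⇒x∈p-y r∈S r≢x , λ r∈ → x∈p-y⇒x≢y r∈ refl)
    where
    ∉S⇒≢r : ∀ {c} → c ∉ S → c ≢ r
    ∉S⇒≢r c∉S refl = c∉S r∈S
    escape : ∀ {c} → Walk (complement G) ⊤ c x → c ∉ S → c ≢ x → c ∈ S′ → x ∈ S′
    escape (here _) _ c≢x _ = ⊥-elim (c≢x refl)
    escape (step {j = z} _ e w) c∉S c≢x c∈S′ with z ≟ x
    ... | yes refl = complement-edge-keeps-side cross′ (∉S⇒≢r c∉S) (r≢x ∘ sym) e c∈S′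
    ... | no z≢x  = escape w z∉S z≢x (complement-edge-keeps-side cross′ (∉S⇒≢r c∉S) (∉S⇒≢r z∉S) e c∈S′)
      where
      z∉S : z ∉ S
      z∉S = x∈∁p⇒x∉p (complement-edge-keeps-side (CompleteAcross-∁ cross) c≢x z≢x e (x∉p⇒x∈∁p c∉S))
    S′-r⊆S-x : S′ - r ⊆ S - x
    S′-r⊆S-x {z} z∈ = x∈p∧x≢y⇒x∈p-y z∈S z≢x
      where
      z∈S′ : z ∈ S′
      z∈S′ = p─q⊆p S′ ⁅ r ⁆ z∈
      z≢x : z ≢ x
      z≢x refl = x∉S′ z∈S′
      z∈S : z ∈ S
      z∈S = decidable-stable (z ∈? S) λ z∉S →
        x∉S′ (escape (complement-connected z x ∈⊤ ∈⊤) z∉S z≢x z∈S′)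

  descent : (∀ x → JoinSplitMinus x) →
            ∀ k {x S r} → CompleteAcross x S → r ≢ x → r ∈ S → ∣ S - x ∣ < k → ⊥
  descent split (suc k) {x} {r = r} cross r≢x r∈S size with split r
  ... | S′ , (a , a≢r , a∈S′) , (b , b≢r , b∉S′) , cross′ with x ∈? S′
  ...   | yes x∈S′ = descent split k (CompleteAcross-∁ cross′) b≢r (x∉p⇒x∈∁p b∉S′)
    (<-≤-trans (shrink cross r≢x r∈S (CompleteAcross-∁ cross′) (x∈p⇒x∉∁p x∈S′)) (≤-pred size))
  ...   | no x∉S′  = descent split k cross′ a≢r a∈S′
    (<-≤-trans (shrink cross r≢x r∈S cross′ x∉S′) (≤-pred size))

  2-connected : 3 ≤ n G → KConnected 2 G
  2-connected 3≤n = 3≤n , connected-without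
    where
    connected-without : ∀ S → ∣ S ∣ < 2 → ConnectedOn G (∁ S)
    connected-without S ∣S∣<2 i j i∈ j∈ with nonempty? S
    ... | no empty = walk-mono (λ {y} _ → x∉p⇒x∈∁p (λ y∈S → empty (y , y∈S))) (connected i j ∈⊤ ∈⊤)
    ... | yes (w , w∈S) = walk-mono ⊤-w⊆∁S (connected-minus w i j (∁S⊆⊤-w i∈) (∁S⊆⊤-w j∈))
      where
      ∁S⊆⊤-w : ∁ S ⊆ ⊤ - w
      ∁S⊆⊤-w y∈ = x∈p∧x≢y⇒x∈p-y ∈⊤ (λ { refl → x∈∁p⇒x∉p y∈ w∈S })
      ⊤-w⊆∁S : ⊤ - w ⊆ ∁ S
      ⊤-w⊆∁S y∈ = x∉p⇒x∈∁p (λ y∈S → ≤⇒≯ (≤-pred ∣S∣<2) (x∈p∧y∈p∧x≢y⇒1<∣p∣ y∈S w∈S (x∈p-y⇒x≢y y∈)))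

  not-3-connected : ¬ KConnected 3 G
  not-3-connected 3-connected@(3<n , _) = start (split x₀)
    where
    split : ∀ x → JoinSplitMinus x
    split x = joinSplitMinus x (3-connected⇒twoConnected-minus 3-connected x)
    x₀ : Fin (n G)
    x₀ = Fin.fromℕ< (≤-trans (s≤s z≤n) 3<n)
    start : JoinSplitMinus x₀ → ⊥
    start (S , (a , a≢x₀ , a∈S) , _ , cross) =
      descent split (suc (n G)) cross a≢x₀ a∈S (s≤s (∣p∣≤n (S - x₀)))

  complement-1-connected : 3 ≤ n G → KConnected 1 (complement G)
  complement-1-connected 3≤n = ≤-trans (s≤s (s≤s z≤n)) 3≤n , λ S ∣S∣<1 i j _ _ →
    walk-mono (λ _ → x∉p⇒x∈∁p (λ y∈S → ≤⇒≯ (≤-pred ∣S∣<1) (x∈p⇒0<∣p∣ y∈S))) (complement-connected i j ∈⊤ ∈⊤)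

  complement-not-2-connected : ∀ {v} → TwoConnectedOn G (⊤ - v) → ¬ KConnected 2 (complement G)
  complement-not-2-connected {v} twoConnected (_ , connected-without) with joinSplitMinus v twoConnected
  ... | S , (a , a≢v , a∈S) , (b , b≢v , b∉S) , cross =
    b∉S (walk-preserves (_∈ S) (λ y∈ z∈ → complement-edge-keeps-side cross (x∈∁⁅y⁆⇒x≢y y∈) (x∈∁⁅y⁆⇒x≢y z∈))
          (connected-without ⁅ v ⁆ (subst (_< 2) (sym (∣⁅x⁆∣≡1 v)) (s≤s (s≤s z≤n))) a b
             (x≢y⇒x∈∁⁅y⁆ a≢v) (x≢y⇒x∈∁⁅y⁆ b≢v))
          a∈S)

  dichotomy : 3 ≤ n G → CriticallyTwoConnected G ⊎
              (VertexConnectivity G 2 × VertexConnectivity (complement G) 1)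
  dichotomy 3≤n with any? (λ v → twoConnectedOn? G (⊤ - v))
  ... | no none     = inj₁ (twoConnected 3≤n , λ v twoConnected-v → none (v , twoConnected-v))
  ... | yes (v , t) = inj₂ ((2-connected 3≤n , not-3-connected) ,
                            (complement-1-connected 3≤n , complement-not-2-connected t))

minimal⇒3≤n : ∀ {G} → IsSimple G → 1 ≤ n G → MinimalNonSesquicograph G → 3 ≤ n G
minimal⇒3≤n {graph zero _} _ () _
minimal⇒3≤n {graph 1 a} simple _ minimal = ⊥-elim (proj₁ minimal (siso K₁≅G k1))
  where
  K₁≅G : K₁ ≅ graph 1 a
  K₁≅G = record { to = id ; from = id ; to-from = λ _ → refl ; from-to = λ _ → refl
                ; pres = λ { zero zero → proj₂ simple zero } }
minimal⇒3≤n {graph 2 a} simple _ minimal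
  with walk⇒neighbour (Minimal.connected simple minimal zero (suc zero) ∈⊤ ∈⊤) (λ ())
     | walk⇒neighbour (Minimal.complement-connected simple minimal zero (suc zero) ∈⊤ ∈⊤) (λ ())
... | zero , loop | _ with trans (sym loop) (proj₂ simple zero)
...   | ()
minimal⇒3≤n {graph 2 a} simple _ minimal | suc zero , edge | suc zero , co-edge rewrite edge with co-edge
...   | ()
minimal⇒3≤n {graph (suc (suc (suc _))) _} _ _ _ = s≤s (s≤s (s≤s z≤n))

lemma3p4 : (G : Graph) → IsSimple G → 1 ≤ n G → MinimalNonSesquicograph G →
    CriticallyTwoConnected G ⊎
    (VertexConnectivity G 2 × VertexConnectivity (complement G) 1)
lemma3p4 G simple 1≤n minimal = Minimal.dichotomy simple minimal (minimal⇒3≤n simple 1≤n minimal)
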